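{- Let $\mathbf{x}\in\{0,1\}^{\mathbb{N}}$ be a recurrent word in which both $0$ and $1$ occur. Then $\mathbf{l}_{1,\rho,\mathbf{x}}=1\,\mathbf{l}_{0,\rho,\mathbf{x}}$ and $\mathbf{l}_{0,\overline{\rho},\mathbf{x}}=0\,\mathbf{l}_{1,\overline{\rho},\mathbf{x}}$; consequently $\mathbf{s}_{1,\rho,\mathbf{x}}=0\,\mathbf{s}_{0,\rho,\mathbf{x}}$ and $\mathbf{s}_{0,\overline{\rho},\mathbf{x}}=1\,\mathbf{s}_{1,\overline{\rho},\mathbf{x}}$.
   Context: A word is recurrent if every finite factor occurs in it infinitely often. $\rho$ is the order $0<1$ and $\overline{\rho}$ the order $1<0$, extended lexicographically. $\mathcal{S}_{\mathbf{x}}$ is the set of infinite binary words all of whose finite factors are factors of $\mathbf{x}$. For a total order $\sigma$ and letter $c$, $\mathbf{l}_{c,\sigma,\mathbf{x}}$ is the lexicographically least word in $\mathcal{S}_{\mathbf{x}}$ beginning with $c$, and $\mathbf{s}_{c,\sigma,\mathbf{x}}$ is defined by $\mathbf{l}_{c,\sigma,\mathbf{x}}=c\,\mathbf{s}_{c,\sigma,\mathbf{x}}$. -}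

module Defs where

open import Data.Bool using (Bool; true; false)
open import Data.Nat using (ℕ; zero; suc; _≤_; _<_)
open import Data.List using (List; []; _∷_; length)
open import Data.Product using (Σ; _×_; ∃)
open import Data.Sum using (_⊎_)
open import Relation.Binary.PropositionalEquality using (_≡_)

-- Binary letters: false = 0, true = 1.
-- Infinite binary words indexed by ℕ.
Word : Set
Word = ℕ → Bool

_∷ʷ_ : Bool → Word → Word
(c ∷ʷ y) zero    = c
(c ∷ʷ y) (suc n) = y n

tailʷ : Word → Word
tailʷ y n = y (suc n)

_≈ʷ_ : Word → Word → Set
y ≈ʷ z = ∀ n → y n ≡ z n

slice : Word → ℕ → ℕ → List Bool
slice x i zero    = []
slice x i (suc n) = x i ∷ slice x (suc i) n

IsFactor : List Bool → Word → Set
IsFactor w x = ∃ λ i → slice x i (length w) ≡ w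

Recurrent : Word → Set
Recurrent x = ∀ w → IsFactor w x → ∀ N → ∃ λ i → N ≤ i × slice x i (length w) ≡ w

InS : Word → Word → Set
InS x y = ∀ w → IsFactor w y → IsFactor w x

-- A total order on letters, given by its strict relation.
LetterOrder : Set₁
LetterOrder = Bool → Bool → Set

ρ : LetterOrder
ρ a b = (a ≡ false) × (b ≡ true)

ρ̄ : LetterOrder
ρ̄ a b = (a ≡ true) × (b ≡ false)

LexLt : LetterOrder → Word → Word → Set
LexLt σ y z = ∃ λ n → (∀ i → i < n → y i ≡ z i) × σ (y n) (z n)

LexLe : LetterOrder → Word → Word → Set
LexLe σ y z = (y ≈ʷ z) ⊎ LexLt σ y z

-- y is l_{c,σ,x}: the lexicographically least word in S_x beginning with c
IsL : Bool → LetterOrder → Word → Word → Set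
IsL c σ x y = InS x y × y 0 ≡ c × (∀ z → InS x z → z 0 ≡ c → LexLe σ y z)

-- y is s_{c,σ,x}: l_{c,σ,x} = c y
IsS : Bool → LetterOrder → Word → Word → Set
IsS c σ x y = IsL c σ x (c ∷ʷ y)

module Submission where

-- Fix a letter c and order the two letters by c < not c (this
-- order is ρ for c = 0 and ρ̄ for c = 1).  Let a = l_{not c} and b = l_c.
-- We show a = (not c) b by proving, by induction on k, that a[1..k+1]
-- agrees with b[0..k].  Assume a[1..k] = b[0..k-1] and compare a(k+1)
-- with b(k):
--   * a(k+1) = c, b(k) = not c: the tail of a lies in S_x, begins with c
--     and is smaller than b, contradicting the minimality of b.
--   * a(k+1) = not c, b(k) = c: by recurrence the prefix b[0..k] occurs in
--     x after an occurrence of not c, so some suffix y of x reads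
--     (not c) c^K b[0..k].  The absorption lemma (minimality of b forbids
--     a run c^K in front of a prefix of b from breaking the agreement with
--     b) shows y = (not c) b[0..k]..., which is smaller than a:
--     contradiction with the minimality of a.

open import Defs
open import Data.Bool using (Bool; true; false; not; _≟_)
open import Data.Bool.Properties using (not-¬; ¬-not)
open import Data.List using ([]; _∷_; length)
open import Data.List.Properties using (∷-injective; ∷-injectiveˡ)
open import Data.Product using (_×_; _,_; proj₁; proj₂; ∃; ∃₂)
open import Data.Sum using (_⊎_; inj₁; inj₂)
open import Data.Empty using (⊥-elim)
open import Data.Nat using (ℕ; zero; suc; _+_; _<_; z≤n; s≤s; _<?_; _≤?_)
open import Data.Nat.Properties
  using (m<1+n⇒m<n∨m≡n; <-cmp; <-≤-trans; ≮⇒≥; +-suc; +-identityʳ; +-assoc; m≤n⇒∃[o]m+o≡n;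
         ≰⇒>; ≤-<-trans; m≤n+m; +-monoʳ-<; <-trans; m<n⇒m<1+n; ≤-refl)
open import Relation.Nullary using (¬_; yes; no; contradiction)
open import Relation.Binary.Definitions using (Asymmetric; tri<; tri≈; tri>)
open import Relation.Binary.PropositionalEquality

Agree : Word → Word → ℕ → Set
Agree y z n = ∀ t → t < n → y t ≡ z t

agree-suc : ∀ {y z n} → Agree y z n → y n ≡ z n → Agree y z (suc n)
agree-suc ag e t t<sn with m<1+n⇒m<n∨m≡n t<sn
... | inj₁ t<n  = ag t t<n
... | inj₂ refl = e

agree-cons : ∀ {y z n} → y 0 ≡ z 0 → Agree (tailʷ y) (tailʷ z) n → Agree y z (suc n)
agree-cons e ag zero    _         = e
agree-cons e ag (suc t) (s≤s t<n) = ag t t<n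

agree-head : ∀ {y z : Word} {d} k → Agree y z k → y k ≡ d → z 0 ≡ d → y 0 ≡ d
agree-head zero    _  yk≡d _    = yk≡d
agree-head (suc k) ag _    z0≡d = trans (ag 0 (s≤s z≤n)) z0≡d

module _ {σ : LetterOrder} (asym : Asymmetric σ) where

  irrefl : ∀ {u v} → u ≡ v → ¬ σ u v
  irrefl refl p = asym p p

  lexLe⇒¬lexLt : ∀ {y z} → LexLe σ y z → ¬ LexLt σ z y
  lexLe⇒¬lexLt (inj₁ y≈z) (n , _ , o) = irrefl (sym (y≈z n)) o
  lexLe⇒¬lexLt (inj₂ (n₁ , ag₁ , o₁)) (n₂ , ag₂ , o₂) with <-cmp n₁ n₂
  ... | tri< lt _ _  = irrefl (sym (ag₂ n₁ lt)) o₁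
  ... | tri≈ _ refl _ = asym o₁ o₂
  ... | tri> _ _ gt  = irrefl (sym (ag₁ n₂ gt)) o₂

  least-unbeaten : ∀ {c x l z} → IsL c σ x l → InS x z → z 0 ≡ c → ¬ LexLt σ z l
  least-unbeaten (_ , _ , least) z∈S z0 = lexLe⇒¬lexLt (least _ z∈S z0)

lexLe-within : ∀ {σ y z} → LexLe σ y z → ∀ n →
               Agree y z n ⊎ ∃ λ m → m < n × Agree y z m × σ (y m) (z m)
lexLe-within (inj₁ y≈z) n = inj₁ (λ t _ → y≈z t)
lexLe-within (inj₂ (m , ag , o)) n with m <? n
... | yes m<n = inj₂ (m , m<n , ag , o)
... | no  m≮n = inj₁ (λ t t<n → ag t (<-≤-trans t<n (≮⇒≥ m≮n)))

ord : Bool → LetterOrder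
ord c u v = (u ≡ c) × (v ≡ not c)

c≢not-c : ∀ c → c ≢ not c
c≢not-c c = not-¬ refl

ord-asym : ∀ c → Asymmetric (ord c)
ord-asym c (u≡c , _) (_ , u≡not-c) = c≢not-c c (trans (sym u≡c) u≡not-c)

ord-total : ∀ c u v → u ≡ v ⊎ ord c u v ⊎ ord c v u
ord-total false false false = inj₁ refl
ord-total false false true  = inj₂ (inj₁ (refl , refl))
ord-total false true  false = inj₂ (inj₂ (refl , refl))
ord-total false true  true  = inj₁ refl
ord-total true  false false = inj₁ refl
ord-total true  false true  = inj₂ (inj₂ (refl , refl))
ord-total true  true  false = inj₂ (inj₁ (refl , refl))
ord-total true  true  true  = inj₁ refl

drop : ℕ → Word → Word
drop s y t = y (s + t)

slice-drop : ∀ y s i n → slice (drop s y) i n ≡ slice y (s + i) n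
slice-drop y s i zero    = refl
slice-drop y s i (suc n) rewrite slice-drop y s (suc i) n | +-suc s i = refl

InS-drop : ∀ {x y} → InS x y → ∀ s → InS x (drop s y)
InS-drop {y = y} y∈S s w (i , eq) = y∈S w (s + i , trans (sym (slice-drop y s i (length w))) eq)

InS-tail : ∀ {x y} → InS x y → InS x (tailʷ y)
InS-tail y∈S = InS-drop y∈S 1

length-slice : ∀ y i n → length (slice y i n) ≡ n
length-slice y i zero    = refl
length-slice y i (suc n) = cong suc (length-slice y (suc i) n)

slice-agree : ∀ y z i j n → slice y i n ≡ slice z j n → Agree (drop i y) (drop j z) n
slice-agree y z i j (suc n) eq zero _ rewrite +-identityʳ i | +-identityʳ j = ∷-injectiveˡ eq
slice-agree y z i j (suc n) eq (suc t) (s≤s t<n) rewrite +-suc i t | +-suc j t =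
  slice-agree y z (suc i) (suc j) n (proj₂ (∷-injective eq)) t t<n

runBefore : ∀ (x : Word) c {j i} → x j ≢ c → j < i →
            ∃₂ λ j' K → suc j' + K ≡ i × x j' ≢ c × (∀ t → t < K → x (j' + suc t) ≡ c)
runBefore x c {j} {suc i} xj≢c j<1+i with x i ≟ c
... | no xi≢c = i , 0 , +-identityʳ (suc i) , xi≢c , λ _ ()
... | yes xi≡c with m<1+n⇒m<n∨m≡n j<1+i
...   | inj₂ refl = contradiction xi≡c xj≢c
...   | inj₁ j<i with runBefore x c xj≢c j<i
...     | j' , K , eq , xj'≢c , run = j' , suc K , trans (+-suc (suc j') K) (cong suc eq) , xj'≢c , run'
  where
  run' : ∀ t → t < suc K → x (j' + suc t) ≡ c
  run' t t<sK with m<1+n⇒m<n∨m≡n t<sK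
  ... | inj₁ t<K  = run t t<K
  ... | inj₂ refl = subst (λ p → x p ≡ c) (sym (trans (+-suc j' K) eq)) xi≡c

-- In a recurrent word x containing a letter other than c, every prefix of
-- a word b of S_x reoccurs after such a letter, hence right after a block
-- d c^K with d ≠ c: some suffix of x reads d c^K followed by b[0..n-1].
runThenPrefix : ∀ {x b} c → Recurrent x → (∃ λ j → x j ≢ c) → InS x b → ∀ n →
                ∃₂ λ y K → InS x y × y 0 ≢ c × (∀ t → t < K → y (suc t) ≡ c)
                         × Agree (drop (suc K) y) b n
runThenPrefix {x} {b} c rec (j , xj≢c) b∈S n
  with rec (slice b 0 n) (b∈S _ (0 , cong (slice b 0) (length-slice b 0 n))) (suc j)
... | i , j<i , occ with runBefore x c xj≢c j<i
... | j' , K , refl , xj'≢c , run =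
  drop j' x , K , InS-drop (λ _ occ → occ) j' , first , run , prefix
  where
  first : x (j' + 0) ≢ c
  first rewrite +-identityʳ j' = xj'≢c
  occ' : slice x (suc j' + K) n ≡ slice b 0 n
  occ' = subst (λ m → slice x (suc j' + K) m ≡ slice b 0 n) (length-slice b 0 n) occ
  prefix : Agree (drop (suc K) (drop j' x)) b n
  prefix t t<n rewrite +-suc j' (K + t) | sym (+-assoc j' K t) =
    slice-agree x b (suc j' + K) 0 n occ' t t<n

module Core (c : Bool) (x : Word) where

  runPrefix-head : ∀ {y z : Word} K → (∀ t → t < K → y t ≡ c) → y (K + 0) ≡ z 0 → z 0 ≡ c → y 0 ≡ c
  runPrefix-head zero    _   yK≡z0 z0≡c = trans yK≡z0 z0≡c
  runPrefix-head (suc K) run _     _    = run 0 (s≤s z≤n)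

  unbeaten : ∀ {c' l z} → IsL c' (ord c) x l → InS x z → z 0 ≡ c' → ¬ LexLt (ord c) z l
  unbeaten = least-unbeaten {ord c} (ord-asym c)

  -- Absorption: if b = l_c and y ∈ S_x reads c^K followed by the first n
  -- letters of b, then y itself agrees with b on its first n letters.
  -- Otherwise b and y first differ at some m = K + r ≥ K with b r = not c,
  -- and the suffix of b at K would be strictly below b.
  absorb : ∀ {b y K n} → IsL c (ord c) x b → InS x y → (∀ t → t < K → y t ≡ c)
           → Agree (drop K y) b n → Agree y b n
  absorb {n = zero} _ _ _ _ t ()
  absorb {b} {y} {K} {suc n} Lb@(b∈S , b0 , least) y∈S run prefix
    with lexLe-within {ord c} (least y y∈S y0) (suc n)
    where
    y0 : y 0 ≡ c
    y0 = runPrefix-head {y} {b} K run (prefix 0 (s≤s z≤n)) b0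
  ... | inj₁ ag = λ t t<n → sym (ag t t<n)
  ... | inj₂ (m , m<n , ag , bm≡c , ym≡not-c) with K ≤? m
  ...   | no K≰m = ⊥-elim (c≢not-c c (trans (sym (run m (≰⇒> K≰m))) ym≡not-c))
  ...   | yes K≤m with m≤n⇒∃[o]m+o≡n K≤m
  ...     | r , refl = ⊥-elim (unbeaten Lb (InS-drop b∈S K) bK≡c
                                 (r , periodic , bm≡c , br≡not-c))
    where
    r<n : r < suc n
    r<n = ≤-<-trans (m≤n+m r K) m<n
    br≡not-c : b r ≡ not c
    br≡not-c = trans (sym (prefix r r<n)) ym≡not-c
    periodic : Agree (drop K b) b r
    periodic t t<r = trans (ag (K + t) (+-monoʳ-< K t<r)) (prefix t (<-trans t<r r<n))
    bK≡c : b (K + 0) ≡ c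
    bK≡c = agree-head r periodic bm≡c b0

  module _ (rec : Recurrent x) (occ : IsFactor (not c ∷ []) x)
           (a b : Word) (La : IsL (not c) (ord c) x a) (Lb : IsL c (ord c) x b) where

    a0 : a 0 ≡ not c
    a0 = proj₁ (proj₂ La)

    b0 : b 0 ≡ c
    b0 = proj₁ (proj₂ Lb)

    step : ∀ k → Agree (tailʷ a) b k → a (suc k) ≡ b k
    step k ag with ord-total c (a (suc k)) (b k)
    ... | inj₁ e = e
    ... | inj₂ (inj₁ smaller) =
      ⊥-elim (unbeaten Lb (InS-tail (proj₁ La)) tail0 (k , ag , smaller))
      where
      tail0 : a 1 ≡ c
      tail0 = agree-head k ag (proj₁ smaller) b0
    ... | inj₂ (inj₂ (bk≡c , ak≡not-c))
      with runThenPrefix c rec (proj₁ occ , notC≢c) (proj₁ Lb) (suc k)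
      where
      notC≢c : x (proj₁ occ) ≢ c
      notC≢c e = c≢not-c c (trans (sym e) (∷-injectiveˡ (proj₂ occ)))
    ...   | y , K , y∈S , y0≢c , run , prefix =
      ⊥-elim (unbeaten La y∈S y0 (suc k , y≈a , yk≡c , ak≡not-c))
      where
      y0 : y 0 ≡ not c
      y0 = ¬-not y0≢c
      tail≈b : Agree (tailʷ y) b (suc k)
      tail≈b = absorb Lb (InS-tail y∈S) run prefix
      y≈a : Agree y a (suc k)
      y≈a = agree-cons (trans y0 (sym a0))
              (λ t t<k → trans (tail≈b t (m<n⇒m<1+n t<k)) (sym (ag t t<k)))
      yk≡c : y (suc k) ≡ c
      yk≡c = trans (tail≈b k ≤-refl) bk≡c

    tail≈b : ∀ k → Agree (tailʷ a) b k
    tail≈b zero    = λ _ ()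
    tail≈b (suc k) = agree-suc (tail≈b k) (step k (tail≈b k))

    result : a ≈ʷ (not c ∷ʷ b)
    result zero    = a0
    result (suc n) = tail≈b (suc n) n ≤-refl

mainTheorem15 : (x : Word) → Recurrent x
    → IsFactor (false ∷ []) x → IsFactor (true ∷ []) x
    → ((l1 l0 : Word) → IsL true ρ x l1 → IsL false ρ x l0 → l1 ≈ʷ (true ∷ʷ l0))
    × ((l0 l1 : Word) → IsL false ρ̄ x l0 → IsL true ρ̄ x l1 → l0 ≈ʷ (false ∷ʷ l1))
    × ((s1 s0 : Word) → IsS true ρ x s1 → IsS false ρ x s0 → s1 ≈ʷ (false ∷ʷ s0))
    × ((s0 s1 : Word) → IsS false ρ̄ x s0 → IsS true ρ̄ x s1 → s0 ≈ʷ (true ∷ʷ s1))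
mainTheorem15 x rec has0 has1 = lρ , lρ̄ , sρ , sρ̄
  where
  -- ρ is ord false and ρ̄ is ord true.
  lρ : (l1 l0 : Word) → IsL true ρ x l1 → IsL false ρ x l0 → l1 ≈ʷ (true ∷ʷ l0)
  lρ = Core.result false x rec has1
  lρ̄ : (l0 l1 : Word) → IsL false ρ̄ x l0 → IsL true ρ̄ x l1 → l0 ≈ʷ (false ∷ʷ l1)
  lρ̄ = Core.result true x rec has0
  -- The s-claims are the l-claims read after the common first letter.
  sρ : (s1 s0 : Word) → IsS true ρ x s1 → IsS false ρ x s0 → s1 ≈ʷ (false ∷ʷ s0)
  sρ s1 s0 S1 S0 n = lρ (true ∷ʷ s1) (false ∷ʷ s0) S1 S0 (suc n)
  sρ̄ : (s0 s1 : Word) → IsS false ρ̄ x s0 → IsS true ρ̄ x s1 → s0 ≈ʷ (true ∷ʷ s1)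
  sρ̄ s0 s1 S0 S1 n = lρ̄ (false ∷ʷ s0) (true ∷ʷ s1) S0 S1 (suc n)
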